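{- The recursion $$P_{\mathbf{u}}=\begin{cases} q(P_{\mathbf{u}'}+P_{\mathbf{u}''}),& u_0=u_N=u_M=0,\\ qP_{\mathbf{u}'},& u_0=0 \text{ and } u_N+u_M>0,\\ t^{\lambda(\mathbf{u})}P_{\mathbf{u}'},& u_0=u_N=u_M=1,\end{cases}$$ (with $\mathbf{u}'=(u_1,\ldots,u_{N+M-1},1)$, $\mathbf{u}''=(u_1,\ldots,u_{N+M-1},0)$, $\lambda(\mathbf{u})=\sum_{i=0}^{M-1}(u_{i+N}-u_i)$) is equivalent to the following recursion: \begin{equation*} \begin{aligned} &P_{0{\bm{v}},0{\bm{w}}}=q(P_{{\bm{v}}\times,{\bm{w}}\times}+P_{{\bm{v}}0,{\bm{w}}0}),\\ &P_{\times{\bm{v}},0{\bm{w}}}=qP_{{\bm{v}}\times,{\bm{w}}\bullet},\\ &P_{0{\bm{v}},\times{\bm{w}}}=qP_{{\bm{v}}\bullet,{\bm{w}}\times},\\ &P_{\times{\bm{v}},\times{\bm{w}}}=qP_{{\bm{v}}\bullet,{\bm{w}}\bullet},\\ &P_{\bullet{\bm{v}},\bullet{\bm{w}}}=t^{|{\bm{v}}|}P_{{\bm{v}}\bullet,{\bm{w}}\bullet}. \end{aligned} \end{equation*}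
   Context: Let $M,N$ be positive integers, $I_{M,N}$ the set of subsets $\Delta\subset\mathbb{Z}_{\ge0}$ with $\Delta+N\subset\Delta$, $\Delta+M\subset\Delta$ and finite complement. For $\mathbf{u}\in\{0,1\}^{N+M}$, $I_{\mathbf{u}}=\{\Delta\in I_{M,N}:\forall\,0\le i<N+M,\ i\in\Delta\Leftrightarrow u_i=1\}$, admissible means $I_{\mathbf{u}}\ne\emptyset$, and $P_{\mathbf{u}}(q,t)=\sum_{\Delta\in I_{\mathbf{u}}}q^{\mathrm{area}(\Delta)}t^{\mathrm{codinv}(\Delta)}$ (area = number of gaps, codinv $=\sum_a\sharp([a,a+M-1]\setminus\Delta)$ over $N$-generators $a$). For admissible $\mathbf{u}$, $(\bm{v},\bm{w})=\mathbf{b}(\mathbf{u})$ where $\bm{v}\in\{0,\bullet,\times\}^M$ has $v_i=0$ if $u_{N+i}=0$, $\bullet$ if $u_{N+i}=u_i=1$, $\times$ if $u_{N+i}=1,u_i=0$, and $\bm{w}\in\{0,\bullet,\times\}^N$ is defined likewise with $M$ in place of $N$; $P_{\bm{v},\bm{w}}:=P_{\mathbf{u}}$. $|\bm{v}|$ is the number of $\times$'s in $\bm{v}$. -}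

module Defs where

open import Level using (Level; _⊔_)
open import Data.Nat as ℕ using (ℕ; zero; suc; _+_; _∸_; _<_; _≤_)
open import Data.Bool using (Bool; true; false; _∧_; not)
open import Data.Fin using (Fin; toℕ)
open import Data.Vec using (Vec; []; _∷_; tabulate; lookup; tail; _∷ʳ_)
open import Data.Product using (Σ; ∃; _×_; _,_)
open import Relation.Binary.PropositionalEquality using (_≡_)
open import Algebra.Bundles using (Semiring)

Subset : Set
Subset = ℕ → Bool

record InI (M N : ℕ) (Δ : Subset) : Set where
  field
    closedN   : ∀ x → Δ x ≡ true → Δ (x + N) ≡ true
    closedM   : ∀ x → Δ x ≡ true → Δ (x + M) ≡ true
    cofinite  : ∃ λ B → ∀ x → B ≤ x → Δ x ≡ true

-- Δ ∈ I_u : for all 0 ≤ i < N+M,  i ∈ Δ ⇔ u_i = 1   (u_i = 1 encoded as true).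
HasPattern : (M N : ℕ) → Subset → Vec Bool (N + M) → Set
HasPattern M N Δ u = ∀ (i : Fin (N + M)) → Δ (toℕ i) ≡ lookup u i

Admissible : (M N : ℕ) → Vec Bool (N + M) → Set
Admissible M N u = Σ Subset λ Δ → InI M N Δ × HasPattern M N Δ u

-- u_i for a natural-number index i (only ever used with i < length;
-- the default value false is never reached in the statement).
at : ∀ {k} → Vec Bool k → ℕ → Bool
at []       _       = false
at (x ∷ xs) zero    = x
at (x ∷ xs) (suc i) = at xs i

data Sym : Set where
  O : Sym   -- 0
  B : Sym   -- •
  X : Sym   -- ×

sym : Bool → Bool → Sym
sym false _     = O
sym true  true  = B
sym true  false = X

bmap : (M N : ℕ) → Vec Bool (N + M) → Vec Sym M × Vec Sym N
bmap M N u =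
  tabulate (λ (i : Fin M) → sym (at u (N + toℕ i)) (at u (toℕ i))) ,
  tabulate (λ (j : Fin N) → sym (at u (M + toℕ j)) (at u (toℕ j)))

countX : ∀ {k} → Vec Sym k → ℕ
countX []       = 0
countX (X ∷ v)  = suc (countX v)
countX (O ∷ v)  = countX v
countX (B ∷ v)  = countX v

bit : Bool → ℕ
bit false = 0
bit true  = 1

sumTo : ℕ → (ℕ → ℕ) → ℕ
sumTo zero    f = 0
sumTo (suc k) f = sumTo k f + f k

-- λ(u) = Σ_{i=0}^{M-1} (u_{i+N} - u_i), computed as Σ u_{i+N} ∸ Σ u_i
-- (the integer value is ≥ 0 for admissible u, so this is the same number).
lam : (M N : ℕ) → Vec Bool (N + M) → ℕ
lam M N u = sumTo M (λ i → bit (at u (i + N))) ∸ sumTo M (λ i → bit (at u i))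

-- The two recursions, for a family F : {0,1}^{N+M} → S (F u plays P_u,
-- and P_{v,w} := F u when (v,w) = b(u) for admissible u), with M = suc m, N = suc n.
module Recursions {c ℓ} (S : Semiring c ℓ) (q t : Semiring.Carrier S) where
  open Semiring S renaming (_+_ to _⊕_; _*_ to _⊛_)
  open import Algebra.Definitions.RawSemiring rawSemiring using (_^_)

  module _ (m n : ℕ) where
    M N : ℕ
    M = suc m
    N = suc n

    u′ : Vec Bool (N + M) → Vec Bool (N + M)
    u′ u = tail u ∷ʳ true

    u″ : Vec Bool (N + M) → Vec Bool (N + M)
    u″ u = tail u ∷ʳ false

    Rec1 : (Vec Bool (N + M) → Carrier) → Set ℓ
    Rec1 F = ∀ (u : Vec Bool (N + M)) → Admissible M N u →
      ( (at u 0 ≡ false → at u N ≡ false → at u M ≡ false →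
           F u ≈ q ⊛ (F (u′ u) ⊕ F (u″ u)))
      × (at u 0 ≡ false → 0 < bit (at u N) + bit (at u M) →
           F u ≈ q ⊛ F (u′ u))
      × (at u 0 ≡ true → at u N ≡ true → at u M ≡ true →
           F u ≈ (t ^ lam M N u) ⊛ F (u′ u)) )

    Rec2 : (Vec Bool (N + M) → Carrier) → Set ℓ
    Rec2 F = ∀ (u : Vec Bool (N + M)) → Admissible M N u →
      ∀ (v : Vec Sym m) (w : Vec Sym n) →
      ( (bmap M N u ≡ (O ∷ v , O ∷ w) → ∀ u₁ u₂ → Admissible M N u₁ → Admissible M N u₂ →
           bmap M N u₁ ≡ (v ∷ʳ X , w ∷ʳ X) → bmap M N u₂ ≡ (v ∷ʳ O , w ∷ʳ O) →
           F u ≈ q ⊛ (F u₁ ⊕ F u₂))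
      × (bmap M N u ≡ (X ∷ v , O ∷ w) → ∀ u₁ → Admissible M N u₁ →
           bmap M N u₁ ≡ (v ∷ʳ X , w ∷ʳ B) → F u ≈ q ⊛ F u₁)
      × (bmap M N u ≡ (O ∷ v , X ∷ w) → ∀ u₁ → Admissible M N u₁ →
           bmap M N u₁ ≡ (v ∷ʳ B , w ∷ʳ X) → F u ≈ q ⊛ F u₁)
      × (bmap M N u ≡ (X ∷ v , X ∷ w) → ∀ u₁ → Admissible M N u₁ →
           bmap M N u₁ ≡ (v ∷ʳ B , w ∷ʳ B) → F u ≈ q ⊛ F u₁)
      × (bmap M N u ≡ (B ∷ v , B ∷ w) → ∀ u₁ → Admissible M N u₁ →
           bmap M N u₁ ≡ (v ∷ʳ B , w ∷ʳ B) → F u ≈ (t ^ countX v) ⊛ F u₁) )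

module Submission where

-- For admissible u the closure of Δ under +N and +M gives u_i ≤ u_{N+i} and
-- u_j ≤ u_{M+j}, so each symbol of (v, w) = b(u) determines both bits it
-- compares; hence b is injective on admissible words and P_{v,w} is well
-- defined.  Passing from u to u′ or u″ drops the heads of v and w and appends
-- sym x u_M and sym x u_N, while the heads themselves encode (u_0, u_N, u_M),
-- and λ(u) counts the ×'s of the tail of v.  Under this dictionary the five
-- clauses of the second recursion are the three clauses of the first.

open import Defs
open import Level using (Level)
open import Function using (_∘_)
open import Data.Nat using (ℕ; zero; suc; _+_; _∸_; _<_; _≤_; s≤s; z<s; s<s; _<?_)
open import Data.Nat.Properties
open import Algebra.Properties.CommutativeSemigroup +-commutativeSemigroup using (interchange)
open import Data.Bool using (Bool; true; false)
open import Data.Fin using (Fin; toℕ; fromℕ<) renaming (zero to fzero; suc to fsuc)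
open import Data.Fin.Properties using (toℕ-fromℕ<; toℕ<n)
open import Data.Vec using (Vec; []; _∷_; tabulate; lookup; tail; _∷ʳ_)
open import Data.Vec.Properties using (∷-injective; ∷-injectiveˡ)
open import Data.Product using (_×_; _,_; proj₁; proj₂)
open import Data.Product.Properties using (,-injective)
open import Relation.Nullary using (yes; no; contradiction)
open import Relation.Binary using (tri<; tri≈; tri>)
open import Relation.Binary.PropositionalEquality
  using (_≡_; refl; trans; cong; cong₂; subst; subst₂; module ≡-Reasoning)
import Relation.Binary.PropositionalEquality as ≡
open import Algebra.Bundles using (Semiring)

private variable
  A : Set
  k : ℕ

at-lookup : (u : Vec Bool k) (i : Fin k) → at u (toℕ i) ≡ lookup u i
at-lookup (x ∷ u) fzero    = refl
at-lookup (x ∷ u) (fsuc i) = at-lookup u i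

at-ext : (u v : Vec Bool k) → (∀ i → i < k → at u i ≡ at v i) → u ≡ v
at-ext []      []      _  = refl
at-ext (x ∷ u) (y ∷ v) eq = cong₂ _∷_ (eq 0 z<s) (at-ext u v (λ i → eq (suc i) ∘ s<s))

at-∷ʳ-< : (u : Vec Bool k) (x : Bool) (i : ℕ) → i < k → at (u ∷ʳ x) i ≡ at u i
at-∷ʳ-< (y ∷ u) x zero    _         = refl
at-∷ʳ-< (y ∷ u) x (suc i) (s≤s i<k) = at-∷ʳ-< u x i i<k

at-∷ʳ-last : (u : Vec Bool k) (x : Bool) → at (u ∷ʳ x) k ≡ x
at-∷ʳ-last []      x = refl
at-∷ʳ-last (y ∷ u) x = at-∷ʳ-last u x

shift : Bool → Vec Bool (suc k) → Vec Bool (suc k)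
shift x u = tail u ∷ʳ x

at-shift-< : (u : Vec Bool (suc k)) (x : Bool) (i : ℕ) → i < k → at (shift x u) i ≡ at u (suc i)
at-shift-< (_ ∷ u) = at-∷ʳ-< u

at-shift-last : (u : Vec Bool (suc k)) (x : Bool) → at (shift x u) k ≡ x
at-shift-last (_ ∷ u) = at-∷ʳ-last u

tabulateℕ : ∀ k → (ℕ → A) → Vec A k
tabulateℕ k g = tabulate (g ∘ toℕ)

tabulateℕ-∷ʳ : ∀ k (g : ℕ → A) → tabulateℕ (suc k) g ≡ tabulateℕ k g ∷ʳ g k
tabulateℕ-∷ʳ zero    g = refl
tabulateℕ-∷ʳ (suc k) g = cong (g 0 ∷_) (tabulateℕ-∷ʳ k (g ∘ suc))

tabulateℕ-cong : ∀ k (g h : ℕ → A) → (∀ i → i < k → g i ≡ h i) →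
                 tabulateℕ k g ≡ tabulateℕ k h
tabulateℕ-cong zero    g h eq = refl
tabulateℕ-cong (suc k) g h eq =
  cong₂ _∷_ (eq 0 z<s) (tabulateℕ-cong k (g ∘ suc) (h ∘ suc) (λ i → eq (suc i) ∘ s<s))

tabulateℕ-injective : ∀ k (g h : ℕ → A) → tabulateℕ k g ≡ tabulateℕ k h →
                      ∀ i → i < k → g i ≡ h i
tabulateℕ-injective (suc k) g h eq zero    _         = ∷-injectiveˡ eq
tabulateℕ-injective (suc k) g h eq (suc i) (s≤s i<k) =
  tabulateℕ-injective k (g ∘ suc) (h ∘ suc) (proj₂ (∷-injective eq)) i i<k

sumTo-cong : ∀ k {f g : ℕ → ℕ} → (∀ i → i < k → f i ≡ g i) → sumTo k f ≡ sumTo k g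
sumTo-cong zero    eq = refl
sumTo-cong (suc k) eq = cong₂ _+_ (sumTo-cong k (λ i → eq i ∘ m<n⇒m<1+n)) (eq k (n<1+n k))

sumTo-+ : ∀ k (f g : ℕ → ℕ) → sumTo k (λ i → f i + g i) ≡ sumTo k f + sumTo k g
sumTo-+ zero    f g = refl
sumTo-+ (suc k) f g =
  trans (cong (_+ (f k + g k)) (sumTo-+ k f g)) (interchange (sumTo k f) (sumTo k g) (f k) (g k))

isX : Sym → ℕ
isX X = 1
isX _ = 0

upper : Sym → Bool
upper O = false
upper _ = true

lower : Sym → Bool
lower B = true
lower _ = false

decodeSym : ∀ {a b s} → (b ≡ true → a ≡ true) → sym a b ≡ s → a ≡ upper s × b ≡ lower s
decodeSym {false} {false} _   refl = refl , refl
decodeSym {false} {true}  b⇒a _    = contradiction (b⇒a refl) λ ()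
decodeSym {true}  {false} _   refl = refl , refl
decodeSym {true}  {true}  _   refl = refl , refl

sym-injective : ∀ {a b a′ b′} → (b ≡ true → a ≡ true) → (b′ ≡ true → a′ ≡ true) →
                sym a b ≡ sym a′ b′ → a ≡ a′ × b ≡ b′
sym-injective b⇒a b′⇒a′ eq with decodeSym b⇒a eq | decodeSym b′⇒a′ refl
... | a≡ , b≡ | a′≡ , b′≡ = trans a≡ (≡.sym a′≡) , trans b≡ (≡.sym b′≡)

isX-sym : ∀ a b → (b ≡ true → a ≡ true) → isX (sym a b) + bit b ≡ bit a
isX-sym false false _   = refl
isX-sym false true  b⇒a = contradiction (b⇒a refl) λ ()
isX-sym true  false _   = refl
isX-sym true  true  _   = refl

countX-∷ʳ : (v : Vec Sym k) (s : Sym) → countX (v ∷ʳ s) ≡ countX v + isX s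
countX-∷ʳ []      O = refl
countX-∷ʳ []      B = refl
countX-∷ʳ []      X = refl
countX-∷ʳ (O ∷ v) s = countX-∷ʳ v s
countX-∷ʳ (B ∷ v) s = countX-∷ʳ v s
countX-∷ʳ (X ∷ v) s = cong suc (countX-∷ʳ v s)

countX-tabulateℕ : ∀ k (g : ℕ → Sym) → countX (tabulateℕ k g) ≡ sumTo k (isX ∘ g)
countX-tabulateℕ zero    g = refl
countX-tabulateℕ (suc k) g = begin
  countX (tabulateℕ (suc k) g)         ≡⟨ cong countX (tabulateℕ-∷ʳ k g) ⟩
  countX (tabulateℕ k g ∷ʳ g k)        ≡⟨ countX-∷ʳ (tabulateℕ k g) (g k) ⟩
  countX (tabulateℕ k g) + isX (g k)   ≡⟨ cong (_+ isX (g k)) (countX-tabulateℕ k g) ⟩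
  sumTo k (isX ∘ g) + isX (g k)        ∎
  where open ≡-Reasoning

-- bmap M N u is definitionally (tabulateℕ M (pairSym u N) , tabulateℕ N (pairSym u M)).
pairSym : Vec Bool k → ℕ → ℕ → Sym
pairSym u s i = sym (at u (s + i)) (at u i)

tabulate-pairSym-shift : (u : Vec Bool (suc k)) (x : Bool) (s l : ℕ) → suc s + l ≡ k →
  tabulateℕ (suc l) (pairSym (shift x u) (suc s))
    ≡ tail (tabulateℕ (suc l) (pairSym u (suc s))) ∷ʳ sym x (at u (suc l))
tabulate-pairSym-shift u x s l s+l≡k =
  trans (tabulateℕ-∷ʳ l (pairSym (shift x u) (suc s))) (cong₂ _∷ʳ_ (tabulateℕ-cong l _ _ body) last)
  where
  body : ∀ i → i < l → pairSym (shift x u) (suc s) i ≡ pairSym u (suc s) (suc i)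
  body i i<l = cong₂ sym
    (trans (at-shift-< u x (suc s + i) (subst (suc s + i <_) s+l≡k (+-monoʳ-< (suc s) i<l)))
           (cong (at u) (≡.sym (+-suc (suc s) i))))
    (at-shift-< u x i (<-≤-trans i<l (subst (l ≤_) s+l≡k (m≤n+m l (suc s)))))
  last : pairSym (shift x u) (suc s) l ≡ sym x (at u (suc l))
  last = cong₂ sym (trans (cong (at (shift x u)) s+l≡k) (at-shift-last u x))
                   (at-shift-< u x l (subst (l <_) s+l≡k (m<n+m l z<s)))

-- The witness for shift b u: Δ − 1 below L, the bit b at L, and everything above L.
shiftSubset : ℕ → Bool → Subset → Subset
shiftSubset L b Δ x with <-cmp x L
... | tri< _ _ _ = Δ (suc x)
... | tri≈ _ _ _ = b
... | tri> _ _ _ = true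

shiftSubset-closed : ∀ L b Δ s → (∀ x → Δ x ≡ true → Δ (x + s) ≡ true) →
  (∀ x → x + s ≡ L → Δ (suc x) ≡ true → b ≡ true) →
  ∀ x → shiftSubset L b Δ x ≡ true → shiftSubset L b Δ (x + s) ≡ true
shiftSubset-closed L b Δ s closed edge x x∈ with <-cmp x L | <-cmp (x + s) L
... | _              | tri> _ _ _       = refl
... | tri< _ _ _     | tri< _ _ _       = closed (suc x) x∈
... | tri< _ _ _     | tri≈ _ x+s≡L _   = edge x x+s≡L x∈
... | tri≈ _ _ _     | tri≈ _ _ _       = x∈
... | tri≈ _ x≡L _   | tri< x+s<L _ _   =
  contradiction (subst (_≤ x + s) x≡L (m≤m+n x s)) (<⇒≱ x+s<L)
... | tri> _ _ L<x   | tri< x+s<L _ _   =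
  contradiction (≤-trans (<⇒≤ L<x) (m≤m+n x s)) (<⇒≱ x+s<L)
... | tri> _ _ L<x   | tri≈ _ x+s≡L _   =
  contradiction (≡.sym x+s≡L) (<⇒≢ (<-≤-trans L<x (m≤m+n x s)))

shiftSubset-cofinite : ∀ L b Δ x → suc L ≤ x → shiftSubset L b Δ x ≡ true
shiftSubset-cofinite L b Δ x L<x with <-cmp x L
... | tri< x<L _ _ = contradiction (<-trans x<L L<x) (<-irrefl refl)
... | tri≈ _ x≡L _ = contradiction (≡.sym x≡L) (<⇒≢ L<x)
... | tri> _ _ _   = refl

shiftSubset-pattern : (u : Vec Bool (suc k)) (b : Bool) (Δ : Subset) →
  (∀ i → i < suc k → Δ i ≡ at u i) → ∀ i → i < suc k → shiftSubset k b Δ i ≡ at (shift b u) i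
shiftSubset-pattern {k} u b Δ Δ≡u i i<1+k with <-cmp i k
... | tri< i<k _ _ = trans (Δ≡u (suc i) (s≤s i<k)) (≡.sym (at-shift-< u b i i<k))
... | tri≈ _ refl _ = ≡.sym (at-shift-last u b)
... | tri> _ _ k<i = contradiction (≤-pred i<1+k) (<⇒≱ k<i)

ClosedUpTo : ℕ → ℕ → Vec Bool k → Set
ClosedUpTo s l u = ∀ i → i < l → at u i ≡ true → at u (s + i) ≡ true

closedUpTo-transfer : (Δ : Subset) (u : Vec Bool k) (s l : ℕ) → s + l ≤ k →
  (∀ i → i < k → Δ i ≡ at u i) → (∀ x → Δ x ≡ true → Δ (x + s) ≡ true) → ClosedUpTo s l u
closedUpTo-transfer Δ u s l s+l≤k Δ≡u closed i i<l uᵢ =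
  trans (≡.sym (Δ≡u (s + i) (<-≤-trans (+-monoʳ-< s i<l) s+l≤k)))
        (subst (λ j → Δ j ≡ true) (+-comm i s)
               (closed i (trans (Δ≡u i (<-≤-trans i<l (≤-trans (m≤n+m l s) s+l≤k))) uᵢ)))

module Admissibility (M N : ℕ) where

  pattern-at : ∀ Δ u → HasPattern M N Δ u → ∀ i → i < N + M → Δ i ≡ at u i
  pattern-at Δ u hp i i<N+M =
    subst (λ j → Δ j ≡ at u j) (toℕ-fromℕ< i<N+M) (trans (hp j) (≡.sym (at-lookup u j)))
    where j = fromℕ< i<N+M

  pattern-from : ∀ Δ u → (∀ i → i < N + M → Δ i ≡ at u i) → HasPattern M N Δ u
  pattern-from Δ u Δ≡u j = trans (Δ≡u (toℕ j) (toℕ<n j)) (at-lookup u j)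

  admissible-closed : ∀ u → Admissible M N u → ClosedUpTo N M u × ClosedUpTo M N u
  admissible-closed u (Δ , inI , hp) =
      closedUpTo-transfer Δ u N M ≤-refl (pattern-at Δ u hp) closedN
    , closedUpTo-transfer Δ u M N (≤-reflexive (+-comm M N)) (pattern-at Δ u hp) closedM
    where open InI inI

  bmap-injective : ∀ u u′ → Admissible M N u → Admissible M N u′ →
                   bmap M N u ≡ bmap M N u′ → u ≡ u′
  bmap-injective u u′ adm adm′ eq = at-ext u u′ same
    where
    c = admissible-closed u adm
    c′ = admissible-closed u′ adm′
    eqᵥ = tabulateℕ-injective M (pairSym u N) (pairSym u′ N) (proj₁ (,-injective eq))
    eqʷ = tabulateℕ-injective N (pairSym u M) (pairSym u′ M) (proj₂ (,-injective eq))
    -- Positions below N are read off w by their lower bit, the others off v by their upper bit.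
    same : ∀ j → j < N + M → at u j ≡ at u′ j
    same j j<N+M with j <? N
    ... | yes j<N = proj₂ (sym-injective (proj₂ c j j<N) (proj₂ c′ j j<N) (eqʷ j j<N))
    ... | no j≮N  = subst (λ i → at u i ≡ at u′ i) (m+[n∸m]≡n (≮⇒≥ j≮N))
                      (proj₁ (sym-injective (proj₁ c i i<M) (proj₁ c′ i i<M) (eqᵥ i i<M)))
      where
      i = j ∸ N
      i<M : i < M
      i<M = subst (i <_) (m+n∸m≡n N M) (∸-monoˡ-< j<N+M (≮⇒≥ j≮N))

module Words (m n : ℕ) where
  M N : ℕ
  M = suc m
  N = suc n

  open Admissibility M N

  vTail : Vec Bool (N + M) → Vec Sym m
  vTail u = tail (proj₁ (bmap M N u))

  wTail : Vec Bool (N + M) → Vec Sym n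
  wTail u = tail (proj₂ (bmap M N u))

  bmap-∷ : ∀ u → bmap M N u ≡ (sym (at u N) (at u 0) ∷ vTail u , sym (at u M) (at u 0) ∷ wTail u)
  bmap-∷ u = cong₂ (λ i j → sym (at u i) (at u 0) ∷ vTail u , sym (at u j) (at u 0) ∷ wTail u)
                   (+-identityʳ N) (+-identityʳ M)

  bmap-∷-at : ∀ u {a b c} → at u N ≡ a → at u M ≡ b → at u 0 ≡ c →
              bmap M N u ≡ (sym a c ∷ vTail u , sym b c ∷ wTail u)
  bmap-∷-at u refl refl refl = bmap-∷ u

  bmap-shift : ∀ x u → bmap M N (shift x u) ≡ (vTail u ∷ʳ sym x (at u M) , wTail u ∷ʳ sym x (at u N))
  bmap-shift x u = cong₂ _,_ (tabulate-pairSym-shift u x n m (≡.sym (+-suc n m)))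
                             (tabulate-pairSym-shift u x m n (+-comm M n))

  bmap-shift-at : ∀ x u {a b} → at u N ≡ a → at u M ≡ b →
                  bmap M N (shift x u) ≡ (vTail u ∷ʳ sym x b , wTail u ∷ʳ sym x a)
  bmap-shift-at x u refl refl = bmap-shift x u

  admissible-shift : ∀ u x → Admissible M N u →
                     (at u M ≡ true → x ≡ true) → (at u N ≡ true → x ≡ true) →
                     Admissible M N (shift x u)
  admissible-shift u x (Δ , inI , hp) M⇒x N⇒x =
      shiftSubset L x Δ
    , record { closedN  = shiftSubset-closed L x Δ N closedN edgeN
             ; closedM  = shiftSubset-closed L x Δ M closedM edgeM
             ; cofinite = suc L , shiftSubset-cofinite L x Δ }
    , pattern-from (shiftSubset L x Δ) (shift x u) (shiftSubset-pattern u x Δ (pattern-at Δ u hp))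
    where
    open InI inI
    L = n + M
    edgeN : ∀ y → y + N ≡ L → Δ (suc y) ≡ true → x ≡ true
    edgeN y y+N≡L y+1∈ =
      M⇒x (trans (≡.sym (pattern-at Δ u hp M (m<n+m M z<s))) (subst (λ z → Δ (suc z) ≡ true) y≡m y+1∈))
      where
      y≡m : y ≡ m
      y≡m = +-cancelʳ-≡ N y m (trans y+N≡L (trans (+-comm n M) (≡.sym (+-suc m n))))
    edgeM : ∀ y → y + M ≡ L → Δ (suc y) ≡ true → x ≡ true
    edgeM y y+M≡L y+1∈ =
      N⇒x (trans (≡.sym (pattern-at Δ u hp N (m<m+n N z<s))) (subst (λ z → Δ (suc z) ≡ true) y≡n y+1∈))
      where
      y≡n : y ≡ n
      y≡n = +-cancelʳ-≡ M y n y+M≡L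

  admissible-shift-true : ∀ u → Admissible M N u → Admissible M N (shift true u)
  admissible-shift-true u adm = admissible-shift u true adm (λ _ → refl) (λ _ → refl)

  zero-closed : ∀ u → Admissible M N u →
                (at u 0 ≡ true → at u N ≡ true) × (at u 0 ≡ true → at u M ≡ true)
  zero-closed u adm =
      subst (λ i → at u i ≡ true) (+-identityʳ N) ∘ proj₁ (admissible-closed u adm) 0 z<s
    , subst (λ i → at u i ≡ true) (+-identityʳ M) ∘ proj₂ (admissible-closed u adm) 0 z<s

  heads : ∀ u {s₁ s₂ v w} → Admissible M N u → bmap M N u ≡ (s₁ ∷ v , s₂ ∷ w) →
          at u 0 ≡ lower s₁ × at u N ≡ upper s₁ × at u M ≡ upper s₂
  heads u adm eq with ,-injective (trans (≡.sym (bmap-∷ u)) eq)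
  ... | eqᵥ , eqʷ with decodeSym (proj₁ (zero-closed u adm)) (∷-injectiveˡ eqᵥ)
                     | decodeSym (proj₂ (zero-closed u adm)) (∷-injectiveˡ eqʷ)
  ... | uN , u₀ | uM , _ = u₀ , uN , uM

  tails : ∀ u {s₁ s₂ v w} → bmap M N u ≡ (s₁ ∷ v , s₂ ∷ w) → vTail u ≡ v × wTail u ≡ w
  tails u eq with ,-injective (trans (≡.sym (bmap-∷ u)) eq)
  ... | eqᵥ , eqʷ = proj₂ (∷-injective eqᵥ) , proj₂ (∷-injective eqʷ)

  bmap-shift-of : ∀ u {s₁ s₂ v w} x → Admissible M N u → bmap M N u ≡ (s₁ ∷ v , s₂ ∷ w) →
                  bmap M N (shift x u) ≡ (v ∷ʳ sym x (upper s₂) , w ∷ʳ sym x (upper s₁))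
  bmap-shift-of u x adm eq with heads u adm eq | tails u eq
  ... | _ , uN , uM | refl , refl = bmap-shift-at x u uN uM

  shift-unique : ∀ u u₁ {s₁ s₂ v w} x →
                 Admissible M N u → Admissible M N (shift x u) → Admissible M N u₁ →
                 bmap M N u ≡ (s₁ ∷ v , s₂ ∷ w) →
                 bmap M N u₁ ≡ (v ∷ʳ sym x (upper s₂) , w ∷ʳ sym x (upper s₁)) → u₁ ≡ shift x u
  shift-unique u u₁ x adm adm⁺ adm₁ eq eq₁ =
    bmap-injective u₁ (shift x u) adm₁ adm⁺ (trans eq₁ (≡.sym (bmap-shift-of u x adm eq)))

  lam≡countX : ∀ u → Admissible M N u → at u 0 ≡ true → lam M N u ≡ countX (vTail u)
  lam≡countX u adm u₀ = begin
    sumTo M (λ i → bit (at u (i + N))) ∸ sumTo M (bit ∘ at u)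
      ≡⟨ cong (_∸ sumTo M (bit ∘ at u)) (sumTo-cong M split) ⟩
    sumTo M (λ i → isX (pairSym u N i) + bit (at u i)) ∸ sumTo M (bit ∘ at u)
      ≡⟨ cong (_∸ sumTo M (bit ∘ at u)) (sumTo-+ M _ _) ⟩
    sumTo M (isX ∘ pairSym u N) + sumTo M (bit ∘ at u) ∸ sumTo M (bit ∘ at u)
      ≡⟨ m+n∸n≡m (sumTo M (isX ∘ pairSym u N)) (sumTo M (bit ∘ at u)) ⟩
    sumTo M (isX ∘ pairSym u N)
      ≡⟨ ≡.sym (countX-tabulateℕ M (pairSym u N)) ⟩
    countX (pairSym u N 0 ∷ vTail u)
      ≡⟨ cong (λ s → countX (s ∷ vTail u)) head≡B ⟩
    countX (vTail u)
      ∎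
    where
    open ≡-Reasoning
    closed = proj₁ (admissible-closed u adm)
    split : ∀ i → i < M → bit (at u (i + N)) ≡ isX (pairSym u N i) + bit (at u i)
    split i i<M = trans (cong (bit ∘ at u) (+-comm i N)) (≡.sym (isX-sym _ _ (closed i i<M)))
    head≡B : pairSym u N 0 ≡ B
    head≡B = cong₂ sym (closed 0 z<s u₀) u₀

module Equivalence {c ℓ} (S : Semiring c ℓ) (q t : Semiring.Carrier S) (m n : ℕ)
                   (F : Vec Bool (suc n + suc m) → Semiring.Carrier S) where
  open Semiring S using (_≈_; rawSemiring) renaming (_+_ to _⊕_; _*_ to _⊛_)
  open import Algebra.Definitions.RawSemiring rawSemiring using (_^_)
  open Recursions S q t using (Rec1; Rec2)
  open Words m n

  rec1⇒rec2 : Rec1 m n F → Rec2 m n F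
  rec1⇒rec2 rec1 u adm v w =
    case-00 , case-q {X} {O} refl z<s , case-q {O} {X} refl z<s , case-q {X} {X} refl z<s , case-••
    where
    adm⁺ = admissible-shift-true u adm

    case-00 : bmap M N u ≡ (O ∷ v , O ∷ w) → ∀ u₁ u₂ → Admissible M N u₁ → Admissible M N u₂ →
              bmap M N u₁ ≡ (v ∷ʳ X , w ∷ʳ X) → bmap M N u₂ ≡ (v ∷ʳ O , w ∷ʳ O) →
              F u ≈ q ⊛ (F u₁ ⊕ F u₂)
    case-00 eq u₁ u₂ adm₁ adm₂ eq₁ eq₂ with heads u adm eq
    ... | u₀ , uN , uM =
      subst₂ (λ u₁ u₂ → F u ≈ q ⊛ (F u₁ ⊕ F u₂))
             (≡.sym (shift-unique u u₁ true adm adm⁺ adm₁ eq eq₁))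
             (≡.sym (shift-unique u u₂ false adm adm⁻ adm₂ eq eq₂))
             (proj₁ (rec1 u adm) u₀ uN uM)
      where adm⁻ = admissible-shift u false adm (trans (≡.sym uM)) (trans (≡.sym uN))

    -- The new last symbols are sym true u_M and sym true u_N, with u_M, u_N read off the heads.
    case-q : ∀ {s₁ s₂} → lower s₁ ≡ false → 0 < bit (upper s₁) + bit (upper s₂) →
             bmap M N u ≡ (s₁ ∷ v , s₂ ∷ w) → ∀ u₁ → Admissible M N u₁ →
             bmap M N u₁ ≡ (v ∷ʳ sym true (upper s₂) , w ∷ʳ sym true (upper s₁)) →
             F u ≈ q ⊛ F u₁
    case-q low pos eq u₁ adm₁ eq₁ with heads u adm eq
    ... | u₀ , uN , uM =
      subst (λ u₁ → F u ≈ q ⊛ F u₁) (≡.sym (shift-unique u u₁ true adm adm⁺ adm₁ eq eq₁))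
            (proj₁ (proj₂ (rec1 u adm)) (trans u₀ low)
                   (subst₂ (λ a b → 0 < bit a + bit b) (≡.sym uN) (≡.sym uM) pos))

    case-•• : bmap M N u ≡ (B ∷ v , B ∷ w) → ∀ u₁ → Admissible M N u₁ →
              bmap M N u₁ ≡ (v ∷ʳ B , w ∷ʳ B) → F u ≈ (t ^ countX v) ⊛ F u₁
    case-•• eq u₁ adm₁ eq₁ with heads u adm eq
    ... | u₀ , uN , uM =
      subst₂ (λ k u₁ → F u ≈ (t ^ k) ⊛ F u₁)
             (trans (lam≡countX u adm u₀) (cong countX (proj₁ (tails u eq))))
             (≡.sym (shift-unique u u₁ true adm adm⁺ adm₁ eq eq₁))
             (proj₂ (proj₂ (rec1 u adm)) u₀ uN uM)

  rec2⇒rec1 : Rec2 m n F → Rec1 m n F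
  rec2⇒rec1 rec2 u adm = case-00 , case-q , case-11
    where
    rec = rec2 u adm (vTail u) (wTail u)
    adm⁺ = admissible-shift-true u adm

    case-00 : at u 0 ≡ false → at u N ≡ false → at u M ≡ false →
              F u ≈ q ⊛ (F (shift true u) ⊕ F (shift false u))
    case-00 u₀ uN uM =
      proj₁ rec (bmap-∷-at u uN uM u₀) (shift true u) (shift false u) adm⁺
            (admissible-shift u false adm (trans (≡.sym uM)) (trans (≡.sym uN)))
            (bmap-shift-at true u uN uM) (bmap-shift-at false u uN uM)

    case-q : at u 0 ≡ false → 0 < bit (at u N) + bit (at u M) → F u ≈ q ⊛ F (shift true u)
    case-q u₀ pos with at u N in uN | at u M in uM
    case-q u₀ () | false | false
    ... | true  | false =
      proj₁ (proj₂ rec) (bmap-∷-at u uN uM u₀) (shift true u) adm⁺ (bmap-shift-at true u uN uM)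
    ... | false | true  =
      proj₁ (proj₂ (proj₂ rec)) (bmap-∷-at u uN uM u₀) (shift true u) adm⁺ (bmap-shift-at true u uN uM)
    ... | true  | true  =
      proj₁ (proj₂ (proj₂ (proj₂ rec))) (bmap-∷-at u uN uM u₀) (shift true u) adm⁺ (bmap-shift-at true u uN uM)

    case-11 : at u 0 ≡ true → at u N ≡ true → at u M ≡ true →
              F u ≈ (t ^ lam M N u) ⊛ F (shift true u)
    case-11 u₀ uN uM =
      subst (λ k → F u ≈ (t ^ k) ⊛ F (shift true u)) (≡.sym (lam≡countX u adm u₀))
            (proj₂ (proj₂ (proj₂ (proj₂ rec))) (bmap-∷-at u uN uM u₀) (shift true u) adm⁺
                                                (bmap-shift-at true u uN uM))

mainTheorem8 : ∀ {c ℓ : Level} (S : Semiring c ℓ) (q t : Semiring.Carrier S) (m n : ℕ)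
    (F : Vec Bool (suc n + suc m) → Semiring.Carrier S) →
    (Recursions.Rec1 S q t m n F → Recursions.Rec2 S q t m n F)
    × (Recursions.Rec2 S q t m n F → Recursions.Rec1 S q t m n F)
mainTheorem8 S q t m n F = rec1⇒rec2 , rec2⇒rec1
  where open Equivalence S q t m n F
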